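{- Let $S$ be a nonempty diagram and $\theta$ a type of shape $S$. Then there exists a box $\mathfrak c\in S$ which is erasable in $\theta$.
   Context: A diagram is a finite subset $S\subset\mathbb N_{>0}^2$; $(a,b)$ is the box in row $a$, column $b$ (matrix coordinates). Arm $A_S(a,b)=\{(a,k)\in S:k>b\}$, leg $L_S(a,b)=\{(k,b)\in S:k\ge a\}$, hook $H_S(a,b)=A_S(a,b)\cup L_S(a,b)$, $h_S=|H_S|$. A type of shape $S$ is a map $\theta:S\to\mathbb Z$ with $0\le\theta(\mathfrak c)\le h_S(\mathfrak c)-1$. A box $\mathfrak c$ is erasable in $\theta$ if $\theta(\mathfrak c)=0$ and $\theta(\mathfrak d)\ne 0$ for every $\mathfrak d\in S\setminus\{\mathfrak c\}$ with $\mathfrak c\in H_S(\mathfrak d)$. -}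

module Defs where

open import Data.Nat using (ℕ; _<_; _≤_; _<?_; _≤?_)
open import Data.Nat.Properties using (_≟_)
open import Data.Integer using (ℤ; +_) renaming (_≤_ to _≤ℤ_; _<_ to _<ℤ_)
open import Data.Product using (_×_; _,_; ∃-syntax)
open import Data.Sum using (_⊎_)
open import Data.List using (List; length; filter)
open import Data.List.Membership.Propositional using (_∈_)
open import Data.List.Relation.Unary.All using (All)
open import Data.List.Relation.Unary.Unique.Propositional using (Unique)
open import Relation.Nullary using (Dec; ¬_)
open import Relation.Nullary.Decidable using (_×-dec_; _⊎-dec_)
open import Relation.Binary.PropositionalEquality using (_≡_; _≢_)

-- A box (a , b): row a, column b (matrix coordinates).
Box : Set
Box = ℕ × ℕ

record Diagram : Set where
  field
    boxes    : List Box
    unique   : Unique boxes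
    positive : All (λ c → 0 < Data.Product.proj₁ c × 0 < Data.Product.proj₂ c) boxes
open Diagram public

InArm : Box → Box → Set
InArm (a , b) (a' , k) = a' ≡ a × b < k

InLeg : Box → Box → Set
InLeg (a , b) (k , b') = b' ≡ b × a ≤ k

InHook : Box → Box → Set
InHook c d = InArm c d ⊎ InLeg c d

inHook? : (c d : Box) → Dec (InHook c d)
inHook? (a , b) (a' , k) = ((a' ≟ a) ×-dec (b <? k)) ⊎-dec ((k ≟ b) ×-dec (a ≤? a'))

hook : Diagram → Box → List Box
hook S c = filter (inHook? c) (boxes S)

hookLength : Diagram → Box → ℕ
hookLength S c = length (hook S c)

-- A type of shape S: θ : S → ℤ with 0 ≤ θ(c) ≤ h_S(c) - 1.
-- θ is given as a function on all boxes; only its values on S matter.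
IsType : Diagram → (Box → ℤ) → Set
IsType S θ = ∀ c → c ∈ boxes S → (+ 0 ≤ℤ θ c) × (θ c <ℤ + hookLength S c)

Erasable : Diagram → (Box → ℤ) → Box → Set
Erasable S θ c =
  θ c ≡ + 0 ×
  (∀ d → d ∈ boxes S → d ≢ c → c ∈ hook S d → θ d ≢ + 0)

-- Every box of the hook of c other than c itself lies on a later antidiagonal (larger a + b).
-- So a box of maximal level has hook length 1 and every type vanishes there. Among the zeros
-- of θ take one, c, of minimal level: a box d ≠ c whose hook contains c has smaller level,
-- hence θ d ≠ 0, and c is erasable.
module Submission where

open import Defs
open import Data.Integer using (ℤ)
open import Data.List using ([])
open import Data.List.Membership.Propositional using (_∈_)
open import Data.Product using (_×_; ∃-syntax)
open import Relation.Binary.PropositionalEquality using (_≢_)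

open import Data.Nat using (ℕ; _+_; z≤n; s≤s) renaming (_≤_ to _≤ℕ_; _<_ to _<ℕ_)
open import Data.Nat.Properties using (_≟_; +-monoʳ-<; +-monoˡ-<; m≤n⇒m<n∨m≡n; <⇒≱)
open import Data.Integer using (+_; +≤+; +<+) renaming (_≤_ to _≤ℤ_; _<_ to _<ℤ_)
open import Data.Integer.Properties using (<-≤-trans) renaming (_≟_ to _≟ℤ_)
open import Data.List using (List; _∷_; length)
open import Data.List.Relation.Unary.All using (_∷_; lookup)
open import Data.List.Relation.Unary.Any using (here; there)
open import Data.List.Relation.Unary.AllPairs using (_∷_)
open import Data.List.Relation.Unary.Unique.Propositional using (Unique)
open import Data.List.Relation.Unary.Unique.Propositional.Properties using (filter⁺)
open import Data.List.Membership.Propositional.Properties using (∈-filter⁺; ∈-filter⁻)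
open import Data.List.Extrema.Nat using (argmin; argmax; argmin-sel; argmax-sel; f[argmin]≤f[⊤]; f[argmin]≤f[xs]; f[⊥]≤f[argmax]; f[xs]≤f[argmax])
open import Data.Product using (_,_; proj₂)
open import Data.Product.Properties using (≡-dec)
open import Data.Sum using (inj₁; inj₂)
open import Data.Empty using (⊥-elim)
open import Relation.Nullary using (Dec; yes; no)
open import Relation.Unary using (Decidable)
open import Relation.Binary.PropositionalEquality using (_≡_; refl; sym; trans)

module _ {A : Set} where

  ∈⇒≢[] : ∀ {x} {xs : List A} → x ∈ xs → xs ≢ []
  ∈⇒≢[] (here _)  ()
  ∈⇒≢[] (there _) ()

  ∃-argmax : (f : A → ℕ) {xs : List A} → xs ≢ [] →
             ∃[ m ] (m ∈ xs × (∀ {y} → y ∈ xs → f y ≤ℕ f m))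
  ∃-argmax f {[]}     xs≢[] = ⊥-elim (xs≢[] refl)
  ∃-argmax f {x ∷ xs} _     = argmax f x xs , argmax∈ , maximal
    where
    argmax∈ : argmax f x xs ∈ x ∷ xs
    argmax∈ with argmax-sel f x xs
    ... | inj₁ m≡x  = here m≡x
    ... | inj₂ m∈xs = there m∈xs
    maximal : ∀ {y} → y ∈ x ∷ xs → f y ≤ℕ f (argmax f x xs)
    maximal (here refl) = f[⊥]≤f[argmax] {f = f} x xs
    maximal (there y∈xs) = lookup (f[xs]≤f[argmax] {f = f} x xs) y∈xs

  ∃-argmin : (f : A → ℕ) {xs : List A} → xs ≢ [] →
             ∃[ m ] (m ∈ xs × (∀ {y} → y ∈ xs → f m ≤ℕ f y))
  ∃-argmin f {[]}     xs≢[] = ⊥-elim (xs≢[] refl)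
  ∃-argmin f {x ∷ xs} _     = argmin f x xs , argmin∈ , minimal
    where
    argmin∈ : argmin f x xs ∈ x ∷ xs
    argmin∈ with argmin-sel f x xs
    ... | inj₁ m≡x  = here m≡x
    ... | inj₂ m∈xs = there m∈xs
    minimal : ∀ {y} → y ∈ x ∷ xs → f (argmin f x xs) ≤ℕ f y
    minimal (here refl) = f[argmin]≤f[⊤] {f = f} x xs
    minimal (there y∈xs) = lookup (f[argmin]≤f[xs] {f = f} x xs) y∈xs

  ∃-argmin-filter : (f : A → ℕ) {P : A → Set} (P? : Decidable P) {x : A} {xs : List A} →
                    x ∈ xs → P x →
                    ∃[ c ] (c ∈ xs × P c × (∀ {y} → y ∈ xs → P y → f c ≤ℕ f y))
  ∃-argmin-filter f P? x∈xs px with ∃-argmin f (∈⇒≢[] (∈-filter⁺ P? x∈xs px))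
  ... | c , c∈filter , minimal with ∈-filter⁻ P? c∈filter
  ...   | c∈xs , pc = c , c∈xs , pc , λ y∈xs py → minimal (∈-filter⁺ P? y∈xs py)

  Unique⇒length≤1 : ∀ {x} {xs : List A} → Unique xs → (∀ {y} → y ∈ xs → y ≡ x) → length xs ≤ℕ 1
  Unique⇒length≤1 {xs = []}        _               _  = z≤n
  Unique⇒length≤1 {xs = _ ∷ []}    _               _  = s≤s z≤n
  Unique⇒length≤1 {xs = y ∷ z ∷ _} ((y≢z ∷ _) ∷ _) ≡x =
    ⊥-elim (y≢z (trans (≡x (here refl)) (sym (≡x (there (here refl))))))

0≤i<1⇒i≡0 : ∀ {i : ℤ} → + 0 ≤ℤ i → i <ℤ + 1 → i ≡ + 0
0≤i<1⇒i≡0 (+≤+ {n = 0}     _) _                 = refl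
0≤i<1⇒i≡0 (+≤+ {n = ℕ.suc _} _) (+<+ (s≤s ()))

level : Box → ℕ
level (a , b) = a + b

level-<-on-hook : ∀ {c d} → c ≢ d → InHook c d → level c <ℕ level d
level-<-on-hook {a , _} _   (inj₁ (refl , b<k)) = +-monoʳ-< a b<k
level-<-on-hook {_ , b} c≢d (inj₂ (refl , a≤k)) with m≤n⇒m<n∨m≡n a≤k
... | inj₁ a<k  = +-monoˡ-< b a<k
... | inj₂ refl = ⊥-elim (c≢d refl)

_≟-box_ : (c d : Box) → Dec (c ≡ d)
_≟-box_ = ≡-dec _≟_ _≟_

∈-hook⁻ : ∀ S {c d} → d ∈ hook S c → d ∈ boxes S × InHook c d
∈-hook⁻ S {c} = ∈-filter⁻ (inHook? c)

∈-hook-of-level-max⇒≡ : ∀ S {m} → (∀ {d} → d ∈ boxes S → level d ≤ℕ level m) →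
                         ∀ {d} → d ∈ hook S m → d ≡ m
∈-hook-of-level-max⇒≡ S {m} maximal {d} d∈hook with m ≟-box d | ∈-hook⁻ S d∈hook
... | yes m≡d | _            = sym m≡d
... | no m≢d  | d∈S , inHook = ⊥-elim (<⇒≱ (level-<-on-hook m≢d inHook) (maximal d∈S))

hookLength-of-level-max≤1 : ∀ S {m} → (∀ {d} → d ∈ boxes S → level d ≤ℕ level m) →
                            hookLength S m ≤ℕ 1
hookLength-of-level-max≤1 S {m} maximal =
  Unique⇒length≤1 (filter⁺ (inHook? m) (unique S)) (∈-hook-of-level-max⇒≡ S maximal)

type-vanishes-where-hookLength≤1 : ∀ S θ {c} → IsType S θ → c ∈ boxes S → hookLength S c ≤ℕ 1 →
                                   θ c ≡ + 0
type-vanishes-where-hookLength≤1 S θ isType c∈S h≤1 with isType _ c∈S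
... | 0≤θc , θc<h = 0≤i<1⇒i≡0 0≤θc (<-≤-trans θc<h (+≤+ h≤1))

mainTheorem3 : (S : Diagram) → boxes S ≢ [] → (θ : Box → ℤ) → IsType S θ →
    ∃[ c ] (c ∈ boxes S × Erasable S θ c)
mainTheorem3 S S≢[] θ isType with ∃-argmax level S≢[]
... | m , m∈S , maximal
  with ∃-argmin-filter level (λ c → θ c ≟ℤ + 0) m∈S
         (type-vanishes-where-hookLength≤1 S θ isType m∈S (hookLength-of-level-max≤1 S maximal))
...   | c , c∈S , θc≡0 , minimal = c , c∈S , θc≡0 , erasable
  where
  erasable : ∀ d → d ∈ boxes S → d ≢ c → c ∈ hook S d → θ d ≢ + 0
  erasable d d∈S d≢c c∈hook θd≡0 =
    <⇒≱ (level-<-on-hook d≢c (proj₂ (∈-hook⁻ S c∈hook))) (minimal d∈S θd≡0)
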